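{- Let $\mathcal{A}$ be either the algebra $\langle\mathbb{N};+\rangle$ or the algebra $\langle\mathbb{N};+,\times\rangle$. A function $f:\mathbb{N}\to\mathbb{N}$ is $\mathcal{A}$-stable preorder preserving if and only if it is monotone non-decreasing and $\mathcal{A}$-congruence preserving.
   Context: A binary relation $\rho$ on $\mathbb{N}$ is $\mathcal{A}$-stable if it is compatible with each operation of $\mathcal{A}$: for a binary operation $\star$ of $\mathcal{A}$, $x\rho y$ and $x'\rho y'$ imply $(x\star x')\rho(y\star y')$. A stable preorder is a reflexive transitive stable relation; a congruence is a stable equivalence relation. $f$ is stable preorder preserving (resp. congruence preserving) if for every stable preorder (resp. congruence) $\preceq$, $x\preceq y$ implies $f(x)\preceq f(y)$. -}

module Defs where

open import Data.Nat using (ℕ; _+_; _*_; _≤_)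
open import Data.List using (List; []; _∷_)
open import Data.List.Membership.Propositional using (_∈_)
open import Relation.Binary.Core using (Rel)
open import Relation.Binary.Definitions using (Reflexive; Symmetric; Transitive)
open import Data.Product using (_×_)

Op₂ : Set
Op₂ = ℕ → ℕ → ℕ

Algebra : Set
Algebra = List Op₂

ℕ+ : Algebra
ℕ+ = _+_ ∷ []

ℕ+× : Algebra
ℕ+× = _+_ ∷ _*_ ∷ []

Compatible : Op₂ → Rel ℕ _ → Set
Compatible _⋆_ ρ = ∀ {x y x' y'} → ρ x y → ρ x' y' → ρ (x ⋆ x') (y ⋆ y')

Stable : Algebra → Rel ℕ _ → Set
Stable A ρ = ∀ {⋆} → ⋆ ∈ A → Compatible ⋆ ρ

IsStablePreorder : Algebra → Rel ℕ _ → Set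
IsStablePreorder A ρ = Reflexive ρ × Transitive ρ × Stable A ρ

IsCongruence : Algebra → Rel ℕ _ → Set
IsCongruence A ρ = Reflexive ρ × Symmetric ρ × Transitive ρ × Stable A ρ

StablePreorderPreserving : Algebra → (ℕ → ℕ) → Set₁
StablePreorderPreserving A f =
  (ρ : Rel ℕ _) → IsStablePreorder A ρ → ∀ {x y} → ρ x y → ρ (f x) (f y)

CongruencePreserving : Algebra → (ℕ → ℕ) → Set₁
CongruencePreserving A f =
  (ρ : Rel ℕ _) → IsCongruence A ρ → ∀ {x y} → ρ x y → ρ (f x) (f y)

Monotone : (ℕ → ℕ) → Set
Monotone f = ∀ {x y} → x ≤ y → f x ≤ f y

-- If f is monotone, it preserves the stable preorder ≤; every congruence is a stable
-- preorder. Conversely let ρ be a stable preorder with x ρ y, say x ≤ y, and d = y − x.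
-- The relation θ x d (equality below x, congruence mod d from x on) is a congruence of
-- ⟨ℕ;+,×⟩ relating x and y, so it relates f x and f y: either f x = f y, or x ≤ f x and,
-- by monotonicity, f y = f x + n d. Adding f x − x to both sides of x ρ x + d gives
-- f x ρ f x + d, and n steps of transitivity give f x ρ f y. The case y ≤ x is the same
-- argument for the opposite preorder.
module Submission where

open import Defs
open import Data.Nat using (ℕ; zero; suc; _+_; _*_; _∸_; _≤_; z≤n)
open import Data.Nat.Properties
open import Data.Nat.Tactic.RingSolver using (solve-∀)
open import Data.Product using (_×_; _,_; ∃; ∃₂)
open import Data.Sum using (_⊎_; inj₁; inj₂; [_,_]′)
open import Data.List.Relation.Unary.Any using (here; there)
open import Function using (flip)
open import Function.Bundles using (_⇔_; mk⇔)
open import Level using (0ℓ)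
open import Relation.Binary.Core using (Rel; _Preserves_⟶_)
open import Relation.Binary.Definitions using (Reflexive; Symmetric; Transitive)
open import Relation.Binary.PropositionalEquality
  using (_≡_; refl; sym; trans; cong; cong₂; subst; subst₂; module ≡-Reasoning)

stable : ∀ {A} {ρ : Rel ℕ 0ℓ} → A ≡ ℕ+ ⊎ A ≡ ℕ+× →
         Compatible _+_ ρ → Compatible _*_ ρ → Stable A ρ
stable (inj₁ refl) +-compat *-compat (here refl)         = +-compat
stable (inj₂ refl) +-compat *-compat (here refl)         = +-compat
stable (inj₂ refl) +-compat *-compat (there (here refl)) = *-compat

stable⇒compatible-+ : ∀ {A} {ρ : Rel ℕ 0ℓ} → A ≡ ℕ+ ⊎ A ≡ ℕ+× →
                      Stable A ρ → Compatible _+_ ρ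
stable⇒compatible-+ (inj₁ refl) st = st (here refl)
stable⇒compatible-+ (inj₂ refl) st = st (here refl)

≤-isStablePreorder : ∀ {A} → A ≡ ℕ+ ⊎ A ≡ ℕ+× → IsStablePreorder A _≤_
≤-isStablePreorder hA = ≤-refl , ≤-trans , stable hA +-mono-≤ *-mono-≤

-- u ≡ v (mod d), phrased without subtraction or division so that d = 0 is allowed.

ModEq : ℕ → Rel ℕ 0ℓ
ModEq d u v = ∃₂ λ i j → u + i * d ≡ v + j * d

modEq-refl : ∀ {d} → Reflexive (ModEq d)
modEq-refl = 0 , 0 , refl

modEq-sym : ∀ {d} → Symmetric (ModEq d)
modEq-sym (i , j , e) = j , i , sym e

modEq-trans : ∀ {d} → Transitive (ModEq d)
modEq-trans {d} {u} {v} {w} (i , j , e) (i' , j' , e') = i + i' , j + j' , (begin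
  u + (i + i') * d      ≡⟨ regroup u i i' d ⟩
  (u + i * d) + i' * d  ≡⟨ cong (_+ i' * d) e ⟩
  (v + j * d) + i' * d  ≡⟨ swap v j i' d ⟩
  (v + i' * d) + j * d  ≡⟨ cong (_+ j * d) e' ⟩
  (w + j' * d) + j * d  ≡⟨ sym (regroup w j' j d) ⟩
  w + (j' + j) * d      ≡⟨ cong (λ k → w + k * d) (+-comm j' j) ⟩
  w + (j + j') * d      ∎)
  where
  open ≡-Reasoning
  regroup : ∀ u i i' d → u + (i + i') * d ≡ (u + i * d) + i' * d
  regroup = solve-∀
  swap : ∀ v j i' d → (v + j * d) + i' * d ≡ (v + i' * d) + j * d
  swap = solve-∀

modEq-+ : ∀ {d} → Compatible _+_ (ModEq d)
modEq-+ {d} {u} {v} {u'} {v'} (i , j , e) (i' , j' , e') = i + i' , j + j' , (begin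
  (u + u') + (i + i') * d      ≡⟨ distribute u u' i i' d ⟩
  (u + i * d) + (u' + i' * d)  ≡⟨ cong₂ _+_ e e' ⟩
  (v + j * d) + (v' + j' * d)  ≡⟨ sym (distribute v v' j j' d) ⟩
  (v + v') + (j + j') * d      ∎)
  where
  open ≡-Reasoning
  distribute : ∀ u u' i i' d → (u + u') + (i + i') * d ≡ (u + i * d) + (u' + i' * d)
  distribute = solve-∀

modEq-* : ∀ {d} → Compatible _*_ (ModEq d)
modEq-* {d} {u} {v} {u'} {v'} (i , j , e) (i' , j' , e') =
  u * i' + i * u' + i * i' * d , v * j' + j * v' + j * j' * d , (begin
  u * u' + (u * i' + i * u' + i * i' * d) * d  ≡⟨ expand u u' i i' d ⟩
  (u + i * d) * (u' + i' * d)                  ≡⟨ cong₂ _*_ e e' ⟩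
  (v + j * d) * (v' + j' * d)                  ≡⟨ sym (expand v v' j j' d) ⟩
  v * v' + (v * j' + j * v' + j * j' * d) * d  ∎)
  where
  open ≡-Reasoning
  expand : ∀ u u' i i' d → u * u' + (u * i' + i * u' + i * i' * d) * d ≡ (u + i * d) * (u' + i' * d)
  expand = solve-∀

modEq-≤⇒≡+multiple : ∀ {d p q} → p ≤ q → ModEq d p q → ∃ λ n → q ≡ p + n * d
modEq-≤⇒≡+multiple {d} {p} {q} p≤q (i , j , e) = i ∸ j , (begin
  q                ≡⟨ sym p+k≡q ⟩
  p + k            ≡⟨ cong (p +_) (sym [i∸j]*d≡k) ⟩
  p + (i ∸ j) * d  ∎)
  where
  open ≡-Reasoning
  k = q ∸ p
  p+k≡q : p + k ≡ q
  p+k≡q = m+[n∸m]≡n p≤q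
  i*d≡k+j*d : i * d ≡ k + j * d
  i*d≡k+j*d = +-cancelˡ-≡ p _ _ (begin
    p + i * d        ≡⟨ e ⟩
    q + j * d        ≡⟨ cong (_+ j * d) (sym p+k≡q) ⟩
    (p + k) + j * d  ≡⟨ +-assoc p k (j * d) ⟩
    p + (k + j * d)  ∎)
  [i∸j]*d≡k : (i ∸ j) * d ≡ k
  [i∸j]*d≡k = begin
    (i ∸ j) * d        ≡⟨ *-distribʳ-∸ d i j ⟩
    i * d ∸ j * d      ≡⟨ cong (_∸ j * d) i*d≡k+j*d ⟩
    k + j * d ∸ j * d  ≡⟨ m+n∸n≡m k (j * d) ⟩
    k                  ∎

θ : ℕ → ℕ → Rel ℕ 0ℓ
θ a d u v = u ≡ v ⊎ (a ≤ u × a ≤ v × ModEq d u v)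

θ-refl : ∀ {a d} → Reflexive (θ a d)
θ-refl = inj₁ refl

θ-sym : ∀ {a d} → Symmetric (θ a d)
θ-sym (inj₁ e)               = inj₁ (sym e)
θ-sym (inj₂ (a≤u , a≤v , m)) = inj₂ (a≤v , a≤u , modEq-sym m)

θ-trans : ∀ {a d} → Transitive (θ a d)
θ-trans (inj₁ refl) uθw = uθw
θ-trans (inj₂ uθv)  (inj₁ refl) = inj₂ uθv
θ-trans (inj₂ (a≤u , _ , m)) (inj₂ (_ , a≤w , m')) = inj₂ (a≤u , a≤w , modEq-trans m m')

θ-+ : ∀ {a d} → Compatible _+_ (θ a d)
θ-+ (inj₁ refl) (inj₁ refl) = inj₁ refl
θ-+ {x = u} (inj₁ refl) (inj₂ (a≤u' , a≤v' , m)) =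
  inj₂ (≤-trans a≤u' (m≤n+m _ u) , ≤-trans a≤v' (m≤n+m _ u) , modEq-+ modEq-refl m)
θ-+ {x' = u'} (inj₂ (a≤u , a≤v , m)) (inj₁ refl) =
  inj₂ (≤-trans a≤u (m≤m+n _ u') , ≤-trans a≤v (m≤m+n _ u') , modEq-+ m modEq-refl)
θ-+ (inj₂ (a≤u , a≤v , m)) (inj₂ (_ , _ , m')) =
  inj₂ (≤-trans a≤u (m≤m+n _ _) , ≤-trans a≤v (m≤m+n _ _) , modEq-+ m m')

θ-* : ∀ {a d} → Compatible _*_ (θ a d)
θ-* (inj₁ refl) (inj₁ refl) = inj₁ refl
θ-* {x = zero} (inj₁ refl) (inj₂ _) = inj₁ refl
θ-* {x = u@(suc _)} (inj₁ refl) (inj₂ (a≤u' , a≤v' , m)) =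
  inj₂ (≤-trans a≤u' (m≤n*m _ u) , ≤-trans a≤v' (m≤n*m _ u) , modEq-* (modEq-refl {x = u}) m)
θ-* {x = u} {y = v} {x' = zero} (inj₂ _) (inj₁ refl) =
  inj₁ (trans (*-zeroʳ u) (sym (*-zeroʳ v)))
θ-* {x' = u'@(suc _)} (inj₂ (a≤u , a≤v , m)) (inj₁ refl) =
  inj₂ (≤-trans a≤u (m≤m*n _ u') , ≤-trans a≤v (m≤m*n _ u') , modEq-* m (modEq-refl {x = u'}))
θ-* (inj₂ (a≤u , a≤v , m)) (inj₂ (a≤u' , a≤v' , m')) =
  inj₂ (≤-* a≤u a≤u' , ≤-* a≤v a≤v' , modEq-* m m')
  where
  ≤-* : ∀ {a m n} → a ≤ m → a ≤ n → a ≤ m * n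
  ≤-* {n = zero}              _   z≤n = z≤n
  ≤-* {m = m} {n = n@(suc _)} a≤m _   = ≤-trans a≤m (m≤m*n m n)

θ-isCongruence : ∀ {A a d} → A ≡ ℕ+ ⊎ A ≡ ℕ+× → IsCongruence A (θ a d)
θ-isCongruence hA = θ-refl , θ-sym , θ-trans , stable hA θ-+ θ-*

module _ {ρ : Rel ℕ 0ℓ} (ρ-refl : Reflexive ρ) (ρ-trans : Transitive ρ) (ρ-+ : Compatible _+_ ρ) where

  step-translate : ∀ {a d m} → ρ a (a + d) → a ≤ m → ρ m (m + d)
  step-translate {a} {d} {m} r a≤m = subst₂ ρ (m∸n+n≡m a≤m) shifted (ρ-+ (ρ-refl {m ∸ a}) r)
    where
    shifted : (m ∸ a) + (a + d) ≡ m + d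
    shifted = trans (sym (+-assoc (m ∸ a) a d)) (cong (_+ d) (m∸n+n≡m a≤m))

  step-iterate : ∀ {m d} → ρ m (m + d) → ∀ n → ρ m (m + n * d)
  step-iterate {m} r zero = subst (ρ m) (sym (+-identityʳ m)) ρ-refl
  step-iterate {m} {d} r (suc n) =
    ρ-trans (step-iterate r n) (subst₂ ρ refl (reassoc m d n) (ρ-+ r (ρ-refl {n * d})))
    where
    reassoc : ∀ m d n → (m + d) + n * d ≡ m + suc n * d
    reassoc = solve-∀

  preserves-≤-related : ∀ {f} → Monotone f → (∀ a d → f Preserves θ a d ⟶ θ a d) →
                        ∀ {x y} → x ≤ y → ρ x y → ρ (f x) (f y)
  preserves-≤-related {f} mono θ-pres {x} {y} x≤y r = conclude (θ-pres x d xθy)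
    where
    d = y ∸ x
    x+d≡y : x + d ≡ y
    x+d≡y = m+[n∸m]≡n x≤y
    xθy : θ x d x y
    xθy = inj₂ (≤-refl , x≤y , 1 , 0 , trans (cong (x +_) (+-identityʳ d))
                                         (trans x+d≡y (sym (+-identityʳ y))))
    conclude : θ x d (f x) (f y) → ρ (f x) (f y)
    conclude (inj₁ e) = subst (ρ (f x)) e ρ-refl
    conclude (inj₂ (x≤fx , _ , m)) with modEq-≤⇒≡+multiple (mono x≤y) m
    ... | n , fy≡ = subst (ρ (f x)) (sym fy≡)
                      (step-iterate (step-translate (subst (ρ x) (sym x+d≡y) r) x≤fx) n)

preserves-stablePreorder : ∀ {A f} {ρ : Rel ℕ 0ℓ} → A ≡ ℕ+ ⊎ A ≡ ℕ+× → Monotone f →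
  CongruencePreserving A f → IsStablePreorder A ρ → f Preserves ρ ⟶ ρ
preserves-stablePreorder {f = f} {ρ} hA mono cp (ρ-refl , ρ-trans , ρ-st) {x} {y} r =
  [ (λ x≤y → preserves-≤-related ρ-refl ρ-trans ρ-+ {f} mono θ-pres x≤y r)
  , (λ y≤x → preserves-≤-related {flip ρ} ρ-refl (flip ρ-trans) ρ-+ {f} mono θ-pres y≤x r)
  ]′ (≤-total x y)
  where
  ρ-+ : Compatible _+_ ρ
  ρ-+ = stable⇒compatible-+ hA ρ-st
  θ-pres : ∀ a d → f Preserves θ a d ⟶ θ a d
  θ-pres a d = cp (θ a d) (θ-isCongruence hA)

theorem3p20 : (A : Algebra) → (A ≡ ℕ+ ⊎ A ≡ ℕ+×) → (f : ℕ → ℕ) →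
    StablePreorderPreserving A f ⇔ (Monotone f × CongruencePreserving A f)
theorem3p20 A hA f = mk⇔ necessary sufficient
  where
  necessary : StablePreorderPreserving A f → Monotone f × CongruencePreserving A f
  necessary sp = sp _≤_ (≤-isStablePreorder hA)
               , λ ρ (ρ-refl , _ , ρ-trans , ρ-st) → sp ρ (ρ-refl , ρ-trans , ρ-st)
  sufficient : Monotone f × CongruencePreserving A f → StablePreorderPreserving A f
  sufficient (mono , cp) ρ = preserves-stablePreorder hA mono cp
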